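{- Let $\vec\alpha\,F$ be an $n$-ary BNF and $\sim$ a type-polymorphic family of relations on $\vec\alpha\,F$ which at every type is an equivalence relation. Suppose (WP) holds: for all relations $\vec R,\vec S$ with $R_i\bullet S_i\neq\emptyset$ for all $i$, $$\mathrm{rel}_F\,\vec R\bullet{\sim}\bullet\mathrm{rel}_F\,\vec S\subseteq{\sim}\bullet\mathrm{rel}_F\,\overrightarrow{(R\bullet S)}\bullet{\sim}.$$ Then (i) $x\sim y$ implies $\mathrm{map}_F\,\vec f\,x\sim\mathrm{map}_F\,\vec f\,y$ for all $\vec f$, and (ii) for all $\vec f$ and $\vec A$ with $f_i^{ -1}\langle A_i\rangle\neq\emptyset$ for all $i$, $(\mathrm{map}_F\,\vec f)^{ -1}\langle\bigcup[F_{\mathrm{in}}\,\vec A]_\sim\rangle\subseteq\bigcup[(\mathrm{map}_F\,\vec f)^{ -1}\langle F_{\mathrm{in}}\,\vec A\rangle]_\sim$.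
   Context: HOL setting (all types non-empty); vector notation $\vec x=x_1,\dots,x_n$. Relations are identified with sets of pairs and $\bullet$ is relation composition. An $n$-ary BNF is a type constructor $\vec\alpha\,F$ with polymorphic mapper $\mathrm{map}_F::(\alpha_1\to\beta_1)\to\cdots\to(\alpha_n\to\beta_n)\to\vec\alpha\,F\to\vec\beta\,F$, setters $\mathrm{set}_{F,i}::\vec\alpha\,F\to\alpha_i\ \mathrm{set}$, infinite cardinal bound $\mathrm{bd}_F$, relator $\mathrm{rel}_F$, satisfying: $\mathrm{map}_F\,\vec{\mathrm{id}}=\mathrm{id}$; $\mathrm{map}_F\,\vec g\circ\mathrm{map}_F\,\vec f=\mathrm{map}_F\,\overrightarrow{(g\circ f)}$; $\mathrm{set}_{F,i}(\mathrm{map}_F\,\vec f\,x)=f_i\langle\mathrm{set}_{F,i}\,x\rangle$; if $f_i z=g_i z$ for all $i$ and $z\in\mathrm{set}_{F,i}\,x$ then $\mathrm{map}_F\,\vec f\,x=\mathrm{map}_F\,\vec g\,x$; $|\mathrm{set}_{F,i}\,x|\le\mathrm{bd}_F$; $(x,y)\in\mathrm{rel}_F\,\vec R$ iff some $z$ has $\mathrm{set}_{F,i}\,z\subseteq R_i$ for all $i$, $\mathrm{map}_F\,\overrightarrow{\mathrm{fst}}\,z=x$, $\mathrm{map}_F\,\overrightarrow{\mathrm{snd}}\,z=y$; $\mathrm{rel}_F\,\vec R\bullet\mathrm{rel}_F\,\vec S\subseteq\mathrm{rel}_F\,\overrightarrow{(R\bullet S)}$. Notation: $f^{ -1}\langle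 X\rangle$ preimage; $F_{\mathrm{in}}\,\vec A=\{x\mid\forall i.\ \mathrm{set}_{F,i}\,x\subseteq A_i\}$; $[x]_\sim=\{y\mid x\sim y\}$, $[A]_\sim=\{[x]_\sim\mid x\in A\}$, $\bigcup[A]_\sim$ = set of elements equivalent to some element of $A$. -}

module Defs where

open import Level using (0ℓ)
open import Data.Nat using (ℕ)
open import Data.Fin using (Fin)
open import Data.Product using (Σ; ∃; _×_; _,_; proj₁; proj₂)
open import Data.Empty using (⊥)
open import Relation.Nullary using (¬_)
open import Relation.Binary.PropositionalEquality using (_≡_)
open import Relation.Binary.Structures using (IsEquivalence)
open import Function.Definitions using (Injective)

-- HOL types are non-empty: we model a HOL type as an Agda type together
-- with an inhabitant (the inhabitant is never used by the BNF operations).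

record Ty : Set₁ where
  constructor ty
  field
    Car : Set
    pt  : Car
open Ty public

_⊗_ : Ty → Ty → Ty
A ⊗ B = ty (Car A × Car B) (pt A , pt B)

Fam : ℕ → Set₁
Fam n = Fin n → Ty

_⊗⃗_ : ∀ {n} → Fam n → Fam n → Fam n
(α ⊗⃗ β) i = α i ⊗ β i

Funs : ∀ {n} → Fam n → Fam n → Set
Funs {n} α β = (i : Fin n) → Car (α i) → Car (β i)

idF : ∀ {n} {α : Fam n} → Funs α α
idF i a = a

_∘F_ : ∀ {n} {α β γ : Fam n} → Funs β γ → Funs α β → Funs α γ
(_∘F_ {α = α} {β} {γ} g f) i a = g i (f i a)

fstF : ∀ {n} {α β : Fam n} → Funs (α ⊗⃗ β) α
fstF i = proj₁

sndF : ∀ {n} {α β : Fam n} → Funs (α ⊗⃗ β) β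
sndF i = proj₂

PSet : Set → Set₁
PSet A = A → Set

_⊆_ : {A : Set} → PSet A → PSet A → Set
X ⊆ Y = ∀ a → X a → Y a

image : {A B : Set} → (A → B) → PSet A → PSet B
image f X b = ∃ λ a → X a × f a ≡ b

preimage : {A B : Set} → (A → B) → PSet B → PSet A
preimage f Y a = Y (f a)

NonEmpty : {A : Set} → PSet A → Set
NonEmpty X = ¬ (∀ a → ¬ X a)

Rel : Set → Set → Set₁
Rel A B = A → B → Set

_⊆ᵣ_ : {A B : Set} → Rel A B → Rel A B → Set
R ⊆ᵣ S = ∀ a b → R a b → S a b

_•_ : {A B C : Set} → Rel A B → Rel B C → Rel A C
(R • S) a c = ∃ λ b → R a b × S b c

NonEmptyRel : {A B : Set} → Rel A B → Set
NonEmptyRel R = ¬ (∀ a b → ¬ R a b)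

Rels : ∀ {n} → Fam n → Fam n → Set₁
Rels {n} α β = (i : Fin n) → Rel (Car (α i)) (Car (β i))

_•⃗_ : ∀ {n} {α β γ : Fam n} → Rels α β → Rels β γ → Rels α γ
(_•⃗_ {α = α} {β} {γ} R S) i = R i • S i

Injective′ : {A B : Set} → (A → B) → Set
Injective′ f = Injective _≡_ _≡_ f

record BNF (n : ℕ) : Set₂ where
  field
    F     : Fam n → Set
    map   : {α β : Fam n} → Funs α β → F α → F β
    set   : {α : Fam n} → (i : Fin n) → F α → PSet (Car (α i))
    Bd    : Set          -- the (carrier of the) cardinal bound bd_F
    rel   : {α β : Fam n} → Rels α β → Rel (F α) (F β)

    map-id   : {α : Fam n} (x : F α) → map {α} {α} (idF {α = α}) x ≡ x
    map-comp : {α β γ : Fam n} (f : Funs α β) (g : Funs β γ) (x : F α) →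
               map {β} {γ} g (map {α} {β} f x) ≡ map {α} {γ} (_∘F_ {α = α} {β} {γ} g f) x
    set-map  : {α β : Fam n} (f : Funs α β) (i : Fin n) (x : F α) (b : Car (β i)) →
               (set {β} i (map {α} {β} f x) b → image (f i) (set {α} i x) b) ×
               (image (f i) (set {α} i x) b → set {β} i (map {α} {β} f x) b)
    map-cong : {α β : Fam n} (f g : Funs α β) (x : F α) →
               (∀ i z → set {α} i x z → f i z ≡ g i z) → map {α} {β} f x ≡ map {α} {β} g x
    bd-infinite : Σ (ℕ → Bd) Injective′
    set-bound : {α : Fam n} (i : Fin n) (x : F α) →
                Σ (Σ (Car (α i)) (set {α} i x) → Bd) Injective′
    rel-def  : {α β : Fam n} (R : Rels α β) (x : F α) (y : F β) →
               (rel R x y →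
                  ∃ λ (z : F (α ⊗⃗ β)) → (∀ i p → set {α ⊗⃗ β} i z p → R i (proj₁ p) (proj₂ p))
                                        × map {α ⊗⃗ β} {α} (fstF {α = α} {β}) z ≡ x × map {α ⊗⃗ β} {β} (sndF {α = α} {β}) z ≡ y) ×
               ((∃ λ (z : F (α ⊗⃗ β)) → (∀ i p → set {α ⊗⃗ β} i z p → R i (proj₁ p) (proj₂ p))
                                        × map {α ⊗⃗ β} {α} (fstF {α = α} {β}) z ≡ x × map {α ⊗⃗ β} {β} (sndF {α = α} {β}) z ≡ y) → rel R x y)
    rel-comp : {α β γ : Fam n} (R : Rels α β) (S : Rels β γ) →
               (rel {α} {β} R • rel {β} {γ} S) ⊆ᵣ rel {α} {γ} (_•⃗_ {α = α} {β} {γ} R S)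

  Fin-set : {α : Fam n} → ((i : Fin n) → PSet (Car (α i))) → PSet (F α)
  Fin-set {α} A x = ∀ i → set {α} i x ⊆ A i

  ⋃cls : {α : Fam n} → Rel (F α) (F α) → PSet (F α) → PSet (F α)
  ⋃cls _∼_ X y = ∃ λ x → X x × x ∼ y

-- Both parts come from (WP) applied to graphs of f.  For (i), take R the converse
-- graph and S the graph of f: from map f x ∼ map f y one gets, up to ∼ on each
-- side, two elements related by rel (graph⁻¹ f •⃗ graph f), which lies in the
-- identity, so they coincide.  For (ii), compose the diagonal restricted to A with
-- the converse graph of f: rel of the composite relates y ∈ F_in A to a v with
-- map f v ∈ F_in A.  The non-emptiness side conditions of (WP) are met by the
-- inhabitants of the HOL types in (i) and by the hypothesis on preimages in (ii).
module Submission where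

open import Defs
open import Data.Fin using (Fin)
open import Data.Product using (_×_; _,_; proj₁; proj₂)
open import Relation.Binary.Structures using (IsEquivalence)
open import Relation.Binary.Definitions using (Transitive)
open import Relation.Binary.PropositionalEquality using (_≡_; refl; sym; trans; subst; module ≡-Reasoning)

module _ {n} (B : BNF n) where
  open BNF B

  graph : {α β : Fam n} → Funs α β → Rels α β
  graph f i a b = f i a ≡ b

  graph⁻¹ : {α β : Fam n} → Funs α β → Rels β α
  graph⁻¹ f i b a = f i a ≡ b

  diagOn : {β : Fam n} → ((i : Fin n) → PSet (Car (β i))) → Rels β β
  diagOn A i b b′ = A i b × b ≡ b′

  rel-map-pointwise : {α β γ : Fam n} (R : Rels β γ) (g : Funs α β) (h : Funs α γ) (x : F α) →
    (∀ i a → set {α} i x a → R i (g i a) (h i a)) →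
    rel {β} {γ} R (map {α} {β} g x) (map {α} {γ} h x)
  rel-map-pointwise {α} {β} {γ} R g h x gRh =
    proj₂ (rel-def R (map g x) (map h x))
      (z , z-in-R , map-comp {α} {β ⊗⃗ γ} {β} ⟨g,h⟩ (fstF {α = β} {γ}) x
                  , map-comp {α} {β ⊗⃗ γ} {γ} ⟨g,h⟩ (sndF {α = β} {γ}) x)
    where
    ⟨g,h⟩ : Funs α (β ⊗⃗ γ)
    ⟨g,h⟩ i a = g i a , h i a
    z : F (β ⊗⃗ γ)
    z = map {α} {β ⊗⃗ γ} ⟨g,h⟩ x
    z-in-R : ∀ i p → set {β ⊗⃗ γ} i z p → R i (proj₁ p) (proj₂ p)
    z-in-R i p p∈z with proj₁ (set-map {α} {β ⊗⃗ γ} ⟨g,h⟩ i x p) p∈z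
    ... | a , a∈x , refl = gRh i a a∈x

  rel-graph : {α β : Fam n} (f : Funs α β) (x : F α) →
    rel {α} {β} (graph {α} {β} f) x (map {α} {β} f x)
  rel-graph {α} {β} f x =
    subst (λ x′ → rel (graph {α} {β} f) x′ (map f x)) (map-id x)
      (rel-map-pointwise {α} {α} {β} (graph {α} {β} f) (idF {α = α}) f x (λ _ _ _ → refl))

  rel-graph⁻¹ : {α β : Fam n} (f : Funs α β) (x : F α) →
    rel {β} {α} (graph⁻¹ {α} {β} f) (map {α} {β} f x) x
  rel-graph⁻¹ {α} {β} f x =
    subst (rel (graph⁻¹ {α} {β} f) (map f x)) (map-id x)
      (rel-map-pointwise {α} {β} {α} (graph⁻¹ {α} {β} f) f (idF {α = α}) x (λ _ _ _ → refl))

  rel-diagOn : {β : Fam n} (A : (i : Fin n) → PSet (Car (β i))) (y : F β) →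
    Fin-set {β} A y → rel {β} {β} (diagOn {β} A) y y
  rel-diagOn {β} A y y∈A =
    subst (λ y′ → rel (diagOn {β} A) y′ y′) (map-id y)
      (rel-map-pointwise {β} {β} {β} (diagOn {β} A) (idF {α = β}) (idF {α = β}) y
        (λ i b b∈y → y∈A i b b∈y , refl))

  rel⇒map-≡ : {α β γ : Fam n} (R : Rels α β) (g : Funs α γ) (h : Funs β γ) (u : F α) (v : F β) →
    (∀ i a b → R i a b → g i a ≡ h i b) →
    rel {α} {β} R u v → map {α} {γ} g u ≡ map {β} {γ} h v
  rel⇒map-≡ {α} {β} {γ} R g h u v gR≡h uRv with proj₁ (rel-def R u v) uRv
  ... | z , z-in-R , refl , refl = begin
    map g (map fst z)           ≡⟨ map-comp {α ⊗⃗ β} {α} {γ} fst g z ⟩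
    map (_∘F_ {α = α ⊗⃗ β} {α} {γ} g fst) z
      ≡⟨ map-cong {α ⊗⃗ β} {γ} _ _ z (λ i p p∈z → gR≡h i _ _ (z-in-R i p p∈z)) ⟩
    map (_∘F_ {α = α ⊗⃗ β} {β} {γ} h snd) z ≡⟨ sym (map-comp {α ⊗⃗ β} {β} {γ} snd h z) ⟩
    map h (map snd z)           ∎
    where
    open ≡-Reasoning
    fst : Funs (α ⊗⃗ β) α
    fst = fstF {α = α} {β}
    snd : Funs (α ⊗⃗ β) β
    snd = sndF {α = α} {β}

  rel⇒≡ : {α : Fam n} (R : Rels α α) (u v : F α) →
    (∀ i a b → R i a b → a ≡ b) → rel {α} {α} R u v → u ≡ v
  rel⇒≡ {α} R u v R⊆≡ uRv = begin
    u                   ≡⟨ sym (map-id u) ⟩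
    map (idF {α = α}) u ≡⟨ rel⇒map-≡ R (idF {α = α}) (idF {α = α}) u v R⊆≡ uRv ⟩
    map (idF {α = α}) v ≡⟨ map-id v ⟩
    v                   ∎
    where open ≡-Reasoning

  rel⇒Fin-setˡ : {α β : Fam n} (R : Rels α β) (A : (i : Fin n) → PSet (Car (α i))) (u : F α) (v : F β) →
    (∀ i a b → R i a b → A i a) →
    rel {α} {β} R u v → Fin-set {α} A u
  rel⇒Fin-setˡ {α} {β} R A u v R⊆A uRv with proj₁ (rel-def R u v) uRv
  ... | z , z-in-R , refl , _ = λ i a a∈u →
    let (p , p∈z , p₁≡a) = proj₁ (set-map {α ⊗⃗ β} {α} (fstF {α = α} {β}) i z a) a∈u
    in subst (A i) p₁≡a (R⊆A i _ _ (z-in-R i p p∈z))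

  WeakPullbackCondition : ({α : Fam n} → F α → F α → Set) → Set₁
  WeakPullbackCondition _∼_ = {α β γ : Fam n} (R : Rels α β) (S : Rels β γ) →
    ((i : Fin n) → NonEmptyRel ((_•⃗_ {α = α} {β} {γ} R S) i)) →
    ((rel {α} {β} R • _∼_ {β}) • rel {β} {γ} S)
      ⊆ᵣ ((_∼_ {α} • rel {α} {γ} (_•⃗_ {α = α} {β} {γ} R S)) • _∼_ {γ})

  graph⁻¹•graph-nonempty : {α β : Fam n} (f : Funs α β) (i : Fin n) →
    NonEmptyRel ((_•⃗_ {α = β} {α} {β} (graph⁻¹ {α} {β} f) (graph {α} {β} f)) i)
  graph⁻¹•graph-nonempty {α} f i empty = empty (f i (pt (α i))) _ (pt (α i) , refl , refl)

  diagOn•graph⁻¹-nonempty : {α β : Fam n} (f : Funs α β) (A : (i : Fin n) → PSet (Car (β i))) (i : Fin n) →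
    NonEmpty (preimage (f i) (A i)) →
    NonEmptyRel ((_•⃗_ {α = β} {β} {α} (diagOn {β} A) (graph⁻¹ {α} {β} f)) i)
  diagOn•graph⁻¹-nonempty {α} {β} f A i f⁻¹A≢∅ empty =
    f⁻¹A≢∅ (λ a fa∈A → empty (f i a) a (f i a , (fa∈A , refl) , refl))

  module _ (_∼_ : {α : Fam n} → F α → F α → Set) (wp : WeakPullbackCondition _∼_) where

    map-preserves-∼ : (∀ {α} → Transitive (_∼_ {α})) →
      {α β : Fam n} (f : Funs α β) (x y : F α) → x ∼ y → map {α} {β} f x ∼ map {α} {β} f y
    map-preserves-∼ ∼-trans {α} {β} f x y x∼y
      with wp (graph⁻¹ {α} {β} f) (graph {α} {β} f) (graph⁻¹•graph-nonempty {α} {β} f)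
              (map f x) (map f y) (y , (x , rel-graph⁻¹ f x , x∼y) , rel-graph f y)
    ... | v , (u , fx∼u , uRv) , v∼fy = ∼-trans fx∼u (subst (_∼ map f y) (sym u≡v) v∼fy)
      where
      u≡v : u ≡ v
      u≡v = rel⇒≡ _ u v (λ i b b′ (_ , fa≡b , fa≡b′) → trans (sym fa≡b) fa≡b′) uRv

    preimage-⋃cls : {α β : Fam n} (f : Funs α β) (A : (i : Fin n) → PSet (Car (β i))) →
      ((i : Fin n) → NonEmpty (preimage (f i) (A i))) →
      preimage (map {α} {β} f) (⋃cls {β} _∼_ (Fin-set {β} A))
        ⊆ ⋃cls {α} _∼_ (preimage (map {α} {β} f) (Fin-set {β} A))
    preimage-⋃cls {α} {β} f A f⁻¹A≢∅ x (y , y∈A , y∼fx)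
      with wp (diagOn {β} A) (graph⁻¹ {α} {β} f) (λ i → diagOn•graph⁻¹-nonempty {α} {β} f A i (f⁻¹A≢∅ i))
              y x (map f x , (y , rel-diagOn A y y∈A , y∼fx) , rel-graph⁻¹ f x)
    ... | v , (u , _ , uRv) , v∼x = v , fv∈A , v∼x
      where
      u≡fv : u ≡ map f v
      u≡fv = trans (sym (map-id u))
        (rel⇒map-≡ _ (idF {α = β}) f u v (λ i b a (_ , (_ , b≡b′) , fa≡b′) → trans b≡b′ (sym fa≡b′)) uRv)
      fv∈A : Fin-set {β} A (map f v)
      fv∈A = subst (Fin-set A) u≡fv (rel⇒Fin-setˡ _ A u v (λ i b a (_ , (b∈A , _) , _) → b∈A) uRv)

lemma3p18 : ∀ {n} (B : BNF n) → let open BNF B in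
    (_∼_ : {α : Fam n} → F α → F α → Set) →
    ({α : Fam n} → IsEquivalence (_∼_ {α})) →
    -- (WP)
    ({α β γ : Fam n} (R : Rels α β) (S : Rels β γ) →
      ((i : Fin n) → NonEmptyRel ((_•⃗_ {α = α} {β} {γ} R S) i)) →
      ((rel {α} {β} R • _∼_ {β}) • rel {β} {γ} S)
        ⊆ᵣ ((_∼_ {α} • rel {α} {γ} (_•⃗_ {α = α} {β} {γ} R S)) • _∼_ {γ})) →
    -- (i)
    ({α β : Fam n} (f : Funs α β) (x y : F α) →
      x ∼ y → map {α} {β} f x ∼ map {α} {β} f y)
    ×
    -- (ii)
    ({α β : Fam n} (f : Funs α β) (A : (i : Fin n) → PSet (Car (β i))) →
      ((i : Fin n) → NonEmpty (preimage (f i) (A i))) →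
      preimage (map {α} {β} f) (⋃cls {β} _∼_ (Fin-set {β} A))
        ⊆ ⋃cls {α} _∼_ (preimage (map {α} {β} f) (Fin-set {β} A)))
lemma3p18 B _∼_ ∼-equiv wp =
  map-preserves-∼ B _∼_ wp (IsEquivalence.trans ∼-equiv) , preimage-⋃cls B _∼_ wp
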